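{- Let $G$ be a graph whose node set $\mathsf{N}_G$ is discrete (has decidable equality), and let $\mathcal{M}:\mathsf{Map}(G)$ be a map for $G$. Then $\mathcal{M}$ is traditionally spherical if and only if $\mathcal{M}$ is spherical, i.e. the type $$\prod_{x,y:\mathsf{N}_G}\ \prod_{w_1,w_2:\mathsf{W}_{U(G)}(x,y)} \|w_1\sim_{\mathcal{M}} w_2\|$$ is logically equivalent (hence, both being propositions, equivalent) to the type $$\prod_{x,y:\mathsf{N}_G}\ \prod_{w_1,w_2:\mathsf{W}_{U(G)}(x,y)} \mathsf{isQuasi}(w_1)\times\mathsf{isQuasi}(w_2)\to\|w_1\sim_{\mathcal{M}} w_2\|.$$
   Context: The setting is homotopy type theory (intensional Martin-Löf type theory with universes $\mathcal{U}$, function extensionality and propositional truncation $\|A\|$). A graph $G$ consists of a set $\mathsf{N}_G$ of nodes and, for all $x,y:\mathsf{N}_G$, a set $\mathsf{E}_G(x,y)$ of edges from $x$ to $y$. Walks are given by the inductive family $\mathsf{W}_G(x,y)$ with constructors $\langle x\rangle:\mathsf{W}_G(x,x)$ (trivial walk) and $e\odot w:\mathsf{W}_G(x,z)$ for $e:\mathsf{E}_G(x,y)$, $w:\mathsf{W}_G(y,z)$; $p\cdot q$ denotes concatenation of walks. For a walk $w:\mathsf{W}_G(x,z)$ and a node $y$, the type $y\in w$ is defined by $y\in\langle z\rangle:\equiv \mathbb{0}$ and $y\in(e\odot w):\equiv (y=\mathsf{source}(e))+(y\in w)$. A walk $w$ is quasi-simple if $\mathsf{isQuasi}(w):\equiv\prod_{z:\mathsf{N}_G}\mathsf{isProp}(z\in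 w)$. The symmetrisation $U(G)$ has node set $\mathsf{N}_G$ and edges $\mathsf{E}_{U(G)}(x,y):\equiv\mathsf{E}_G(x,y)+\mathsf{E}_G(y,x)$. For $n:\mathbb{N}$, $⟦n⟧$ is the standard $n$-element type and $\mathsf{pred}:⟦n⟧\to⟦n⟧$ maps $0\mapsto n-1$, $m+1\mapsto m$. $\mathsf{Cyclic}(A):\equiv\sum_{\varphi:A\to A}\sum_{n:\mathbb{N}}\|\sum_{e:A\simeq⟦n⟧}(e\circ\varphi=\mathsf{pred}\circ e)\|$. A map for $G$ is an element of $\mathsf{Map}(G):\equiv\prod_{x:\mathsf{N}_G}\mathsf{Cyclic}(\sum_{y:\mathsf{N}_G}\mathsf{E}_{U(G)}(x,y))$ (a rotation system). A map $\mathcal{M}$ determines faces; each face $\mathcal{F}$ consists of a cyclic subgraph $A$ of $U(G)$ with a function $f$ from the nodes of $A$ to $\mathsf{N}_G$, and for nodes $a,b$ of $A$ it provides two walks $\mathsf{cw}_{\mathcal{F}}(a,b)$ and $\mathsf{ccw}_{\mathcal{F}}(a,b)$ in $U(G)$ from $f(a)$ to $f(b)$ (the face boundary traversed clockwise and counter-clockwise). Walk homotopy $w_1\sim_{\mathcal{M}}w_2$ for $w_1,w_2:\mathsf{W}_{U(G)}(x,y)$ is the inductive family with constructors $\mathsf{hrefl},\mathsf{hsym},\mathsf{htrans}$ (reflexivity, symmetry, transitivity) and $\mathsf{hcollapse}$: for a face $\mathcal{F}=\langle A,f\rangle$, nodes $a,b$ of $A$, and walks $w_1:\mathsf{W}_{U(G)}(x,f(a))$,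 $w_2:\mathsf{W}_{U(G)}(f(b),y)$, one has $(w_1\cdot\mathsf{ccw}_{\mathcal{F}}(a,b)\cdot w_2)\sim_{\mathcal{M}}(w_1\cdot\mathsf{cw}_{\mathcal{F}}(a,b)\cdot w_2)$. $\mathcal{M}$ is called traditionally spherical if the first displayed type is inhabited, and spherical if the second is. -}

module Defs where

open import Level using (Level; _⊔_) renaming (suc to lsuc; zero to lzero)
open import Data.Nat using (ℕ; zero; suc; _<_)
open import Data.Fin using (Fin; fromℕ; inject₁) renaming (zero to fzero; suc to fsuc)
open import Data.Product using (Σ; _,_; proj₁; proj₂; _×_)
open import Data.Sum using (_⊎_; inj₁; inj₂)
open import Data.Empty using (⊥)
open import Function.Bundles using (_↔_; Inverse)
open import Relation.Binary.PropositionalEquality using (_≡_; subst)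

isProp : ∀ {a} → Set a → Set a
isProp A = (x y : A) → x ≡ y

isSet : ∀ {a} → Set a → Set a
isSet A = (x y : A) → isProp (x ≡ y)

∥_∥ : ∀ {a} → Set a → Set (lsuc a)
∥_∥ {a} A = (P : Set a) → isProp P → (A → P) → P

record Graph : Set₁ where
  field
    N : Set
    E : N → N → Set
open Graph public

isSetGraph : Graph → Set
isSetGraph G = isSet (N G) × ((x y : N G) → isSet (E G x y))

data W (G : Graph) : N G → N G → Set where
  ⟨_⟩  : (x : N G) → W G x x
  _⊙_ : ∀ {x y z} → E G x y → W G y z → W G x z

infixr 5 _⊙_ _·_

_·_ : ∀ {G x y z} → W G x y → W G y z → W G x z
⟨ _ ⟩ · q = q
(e ⊙ p) · q = e ⊙ (p · q)

-- y ∈ w  (membership of a node as the source of some edge of w)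
_∈_ : ∀ {G x z} → N G → W G x z → Set
y ∈ ⟨ _ ⟩ = ⊥
_∈_ {x = x} y (e ⊙ w) = (y ≡ x) ⊎ (y ∈ w)

isQuasi : ∀ {G x z} → W G x z → Set
isQuasi {G} w = (z : N G) → isProp (z ∈ w)

U : Graph → Graph
U G = record { N = N G ; E = λ x y → E G x y ⊎ E G y x }

flip : ∀ {G x y} → E (U G) x y → E (U G) y x
flip (inj₁ e) = inj₂ e
flip (inj₂ e) = inj₁ e

rev : ∀ {G x y} → W (U G) x y → W (U G) y x
rev ⟨ x ⟩ = ⟨ x ⟩
rev {G} (_⊙_ {x} e w) = rev w · (flip {G} e ⊙ ⟨ x ⟩)

predFin : ∀ {n} → Fin n → Fin n
predFin {suc n} fzero = fromℕ n
predFin {suc n} (fsuc m) = inject₁ m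

record Cyclic (A : Set) : Set₁ where
  field
    φ    : A → A
    size : ℕ
    iso  : ∥ Σ (A ↔ Fin size) (λ e → (a : A) → Inverse.to e (φ a) ≡ predFin (Inverse.to e a)) ∥
open Cyclic public

-- Map(G): a rotation system
Map : Graph → Set₁
Map G = (x : N G) → Cyclic (Σ (N G) (λ y → E (U G) x y))

iter : ∀ {A : Set} → (A → A) → ℕ → A → A
iter f zero a = a
iter f (suc k) a = iter f k (f a)

-- Faces of a map: a cyclic graph A (node a has the single outgoing edge
-- a → next a) with a graph homomorphism ⟨f , edge⟩ into U(G) such that
-- consecutive edges follow the rotation system.

record Face {G : Graph} (M : Map G) : Set₁ where
  field
    A    : Set
    cyc  : Cyclic A
    f    : A → N G
    edge : (a : A) → E (U G) (f a) (f (φ cyc a))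
    compat : (a : A) →
      φ (M (f (φ cyc a))) (f a , flip {G} (edge a))
        ≡ (f (φ cyc (φ cyc a)) , edge (φ cyc a))

module _ {G : Graph} {M : Map G} (F : Face M) where
  open Face F

  faceWalk : (a : A) (k : ℕ) → W (U G) (f a) (f (iter (φ cyc) k a))
  faceWalk a zero = ⟨ f a ⟩
  faceWalk a (suc k) = edge a ⊙ faceWalk (φ cyc a) k

  -- cw_F(a , b) for b = next^k(a), k < size
  cw : (a : A) (k : ℕ) → W (U G) (f a) (f (iter (φ cyc) k a))
  cw = faceWalk

  -- ccw_F(a , b) for b = next^k(a) and a = next^l(b), l < size:
  -- the reversal of cw_F(b , a)
  ccw : (a : A) (k l : ℕ) → iter (φ cyc) l (iter (φ cyc) k a) ≡ a →
        W (U G) (f a) (f (iter (φ cyc) k a))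
  ccw a k l eq =
    subst (λ t → W (U G) (f t) (f (iter (φ cyc) k a))) eq
          (rev {G} (faceWalk (iter (φ cyc) k a) l))

data Homotopy {G : Graph} (M : Map G) : {x y : N G} → W (U G) x y → W (U G) x y → Set₁ where
  hrefl  : ∀ {x y} {w : W (U G) x y} → Homotopy M w w
  hsym   : ∀ {x y} {w₁ w₂ : W (U G) x y} → Homotopy M w₁ w₂ → Homotopy M w₂ w₁
  htrans : ∀ {x y} {w₁ w₂ w₃ : W (U G) x y} →
           Homotopy M w₁ w₂ → Homotopy M w₂ w₃ → Homotopy M w₁ w₃
  hcollapse : ∀ {x y} (F : Face M) (a : Face.A F) (k l : ℕ) →
           k < size (Face.cyc F) → l < size (Face.cyc F) →
           (eq : iter (φ (Face.cyc F)) l (iter (φ (Face.cyc F)) k a) ≡ a) →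
           (w₁ : W (U G) x (Face.f F a)) →
           (w₂ : W (U G) (Face.f F (iter (φ (Face.cyc F)) k a)) y) →
           Homotopy M (w₁ · (ccw F a k l eq · w₂)) (w₁ · (cw F a k · w₂))

{-# OPTIONS --safe #-}
-- Under sphericity every walk is homotopic to a quasi-simple one, by loop erasure.
-- Having replaced the tail w of e ⊙ w (e starting at x) by a quasi-simple s, either
-- x does not occur in s and e ⊙ s is quasi-simple, or s = a · b where b starts at
-- the first visit of x; then e ⊙ a is a quasi-simple loop at x, homotopic to ⟨ x ⟩
-- by sphericity, so e ⊙ s ∼ b, a suffix of s and hence quasi-simple. Two walks
-- with the same endpoints are then homotopic through their quasi-simple
-- representatives.
module Submission where

open import Defs
open import Level using (Level)
open import Data.Product using (Σ; _,_; _×_)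
open import Data.Sum using (_⊎_; inj₁; inj₂; [_,_]; map₁)
open import Data.Sum.Properties using (inj₁-injective; inj₂-injective)
open import Data.Empty using (⊥-elim)
open import Relation.Nullary using (Dec; yes; no; ¬_)
open import Relation.Binary.Definitions using (DecidableEquality)
open import Relation.Binary.PropositionalEquality
  using (_≡_; refl; sym; trans; cong; subst; subst₂)
open import Axiom.UniquenessOfIdentityProofs using (module Decidable⇒UIP)
open import Function.Bundles using (_⇔_; mk⇔)

private variable
  ℓ : Level

∣_∣ : {A : Set ℓ} → A → ∥ A ∥
∣ x ∣ _ _ k = k x

∥-map : {A B : Set ℓ} → (A → B) → ∥ A ∥ → ∥ B ∥
∥-map f ∣x∣ P isPropP k = ∣x∣ P isPropP (λ x → k (f x))

∥-map₂ : {A B C : Set ℓ} → (A → B → C) → ∥ A ∥ → ∥ B ∥ → ∥ C ∥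
∥-map₂ f ∣x∣ ∣y∣ P isPropP k = ∣x∣ P isPropP (λ x → ∣y∣ P isPropP (λ y → k (f x y)))

DecidableEquality⇒isSet : {A : Set ℓ} → DecidableEquality A → isSet A
DecidableEquality⇒isSet _≟_ _ _ = Decidable⇒UIP.≡-irrelevant _≟_

module _ {A B : Set} where

  isProp-retract : (s : A → B) (r : B → A) → (∀ x → r (s x) ≡ x) → isProp B → isProp A
  isProp-retract s r rs isPropB x y =
    trans (sym (rs x)) (trans (cong r (isPropB (s x) (s y))) (rs y))

  isProp-⊎ˡ : isProp (A ⊎ B) → isProp A
  isProp-⊎ˡ isProp⊎ x y = inj₁-injective (isProp⊎ (inj₁ x) (inj₁ y))

  isProp-⊎ʳ : isProp (A ⊎ B) → isProp B
  isProp-⊎ʳ isProp⊎ x y = inj₂-injective (isProp⊎ (inj₂ x) (inj₂ y))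

module _ {G : Graph} where

  ·-assoc : ∀ {x y z u} (p : W G x y) (q : W G y z) (r : W G z u) →
            (p · q) · r ≡ p · (q · r)
  ·-assoc ⟨ _ ⟩   q r = refl
  ·-assoc (e ⊙ p) q r = cong (e ⊙_) (·-assoc p q r)

  ·-assoc₄ : ∀ {x y z u v} (p : W G x y) (q : W G y z) (r : W G z u) (t : W G u v) →
             (p · q · r) · t ≡ p · q · r · t
  ·-assoc₄ p q r t = trans (·-assoc p (q · r) t) (cong (p ·_) (·-assoc q r t))

  ∈-·⁺ : ∀ {x y z} {n : N G} (p : W G x y) (q : W G y z) → n ∈ p ⊎ n ∈ q → n ∈ (p · q)
  ∈-·⁺ ⟨ _ ⟩   q (inj₂ n∈q)          = n∈q
  ∈-·⁺ (e ⊙ p) q (inj₁ (inj₁ n≡x))   = inj₁ n≡x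
  ∈-·⁺ (e ⊙ p) q (inj₁ (inj₂ n∈p))   = inj₂ (∈-·⁺ p q (inj₁ n∈p))
  ∈-·⁺ (e ⊙ p) q (inj₂ n∈q)          = inj₂ (∈-·⁺ p q (inj₂ n∈q))

  ∈-·⁻ : ∀ {x y z} {n : N G} (p : W G x y) (q : W G y z) → n ∈ (p · q) → n ∈ p ⊎ n ∈ q
  ∈-·⁻ ⟨ _ ⟩   q n∈q           = inj₂ n∈q
  ∈-·⁻ (e ⊙ p) q (inj₁ n≡x)    = inj₁ (inj₁ n≡x)
  ∈-·⁻ (e ⊙ p) q (inj₂ n∈p·q)  = map₁ inj₂ (∈-·⁻ p q n∈p·q)

  ∈-·⁻∘∈-·⁺ : ∀ {x y z} {n : N G} (p : W G x y) (q : W G y z) (n∈ : n ∈ p ⊎ n ∈ q) →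
              ∈-·⁻ p q (∈-·⁺ p q n∈) ≡ n∈
  ∈-·⁻∘∈-·⁺ ⟨ _ ⟩   q (inj₂ n∈q)        = refl
  ∈-·⁻∘∈-·⁺ (e ⊙ p) q (inj₁ (inj₁ n≡x)) = refl
  ∈-·⁻∘∈-·⁺ (e ⊙ p) q (inj₁ (inj₂ n∈p)) = cong (map₁ inj₂) (∈-·⁻∘∈-·⁺ p q (inj₁ n∈p))
  ∈-·⁻∘∈-·⁺ (e ⊙ p) q (inj₂ n∈q)        = cong (map₁ inj₂) (∈-·⁻∘∈-·⁺ p q (inj₂ n∈q))

  isProp-∈-⊎ : ∀ {x y z} (p : W G x y) (q : W G y z) →
               isQuasi (p · q) → (n : N G) → isProp (n ∈ p ⊎ n ∈ q)
  isProp-∈-⊎ p q quasi n =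
    isProp-retract (∈-·⁺ p q) (∈-·⁻ p q) (∈-·⁻∘∈-·⁺ p q) (quasi n)

  isQuasi-·ˡ : ∀ {x y z} (p : W G x y) (q : W G y z) → isQuasi (p · q) → isQuasi p
  isQuasi-·ˡ p q quasi n = isProp-⊎ˡ (isProp-∈-⊎ p q quasi n)

  isQuasi-·ʳ : ∀ {x y z} (p : W G x y) (q : W G y z) → isQuasi (p · q) → isQuasi q
  isQuasi-·ʳ p q quasi n = isProp-⊎ʳ (isProp-∈-⊎ p q quasi n)

  isQuasi-⟨⟩ : (x : N G) → isQuasi {G} ⟨ x ⟩
  isQuasi-⟨⟩ x n ()

  isQuasi-⊙ : isSet (N G) → ∀ {x y z} (e : E G x y) {s : W G y z} →
              isQuasi s → ¬ x ∈ s → isQuasi (e ⊙ s)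
  isQuasi-⊙ isSetN e quasi x∉s n (inj₁ n≡x) (inj₁ n≡x′) = cong inj₁ (isSetN _ _ n≡x n≡x′)
  isQuasi-⊙ isSetN e quasi x∉s n (inj₁ n≡x) (inj₂ n∈s)  = ⊥-elim (x∉s (subst (_∈ _) n≡x n∈s))
  isQuasi-⊙ isSetN e quasi x∉s n (inj₂ n∈s) (inj₁ n≡x)  = ⊥-elim (x∉s (subst (_∈ _) n≡x n∈s))
  isQuasi-⊙ isSetN e quasi x∉s n (inj₂ n∈s) (inj₂ n∈s′) = cong inj₂ (quasi n n∈s n∈s′)

  record FirstVisit (x : N G) {y z : N G} (s : W G y z) : Set where
    constructor firstVisit
    field
      before         : W G y x
      after          : W G x z
      x∉before       : ¬ x ∈ before
      s≡before·after : s ≡ before · after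

  firstVisit? : DecidableEquality (N G) → (x : N G) → ∀ {y z} (s : W G y z) →
                FirstVisit x s ⊎ ¬ x ∈ s
  firstVisit? _≟_ x ⟨ _ ⟩ = inj₂ λ ()
  firstVisit? _≟_ x (_⊙_ {y} e s) with x ≟ y
  ... | yes refl = inj₁ (firstVisit ⟨ x ⟩ (e ⊙ s) (λ ()) refl)
  ... | no x≢y with firstVisit? _≟_ x s
  ...   | inj₁ (firstVisit a b x∉a refl) = inj₁ (firstVisit (e ⊙ a) b [ x≢y , x∉a ] refl)
  ...   | inj₂ x∉s                      = inj₂ [ x≢y , x∉s ]

module _ {G : Graph} (M : Map G) where

  ⊙-cong : ∀ {x y z} (e : E (U G) x y) {w₁ w₂ : W (U G) y z} →
           Homotopy M w₁ w₂ → Homotopy M (e ⊙ w₁) (e ⊙ w₂)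
  ⊙-cong e hrefl          = hrefl
  ⊙-cong e (hsym h)       = hsym (⊙-cong e h)
  ⊙-cong e (htrans h h′)  = htrans (⊙-cong e h) (⊙-cong e h′)
  ⊙-cong e (hcollapse F a k l k< l< eq w₁ w₂) = hcollapse F a k l k< l< eq (e ⊙ w₁) w₂

  ·-congʳ : ∀ {x y z} (r : W (U G) y z) {w₁ w₂ : W (U G) x y} →
            Homotopy M w₁ w₂ → Homotopy M (w₁ · r) (w₂ · r)
  ·-congʳ r hrefl         = hrefl
  ·-congʳ r (hsym h)      = hsym (·-congʳ r h)
  ·-congʳ r (htrans h h′) = htrans (·-congʳ r h) (·-congʳ r h′)
  ·-congʳ r (hcollapse F a k l k< l< eq w₁ w₂) =
    subst₂ (Homotopy M) (sym (·-assoc₄ w₁ _ w₂ r)) (sym (·-assoc₄ w₁ _ w₂ r))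
      (hcollapse F a k l k< l< eq w₁ (w₂ · r))

  isTraditionallySpherical : Set₂
  isTraditionallySpherical =
    (x y : N G) (w₁ w₂ : W (U G) x y) → ∥ Homotopy M w₁ w₂ ∥

  isSpherical : Set₂
  isSpherical =
    (x y : N G) (w₁ w₂ : W (U G) x y) →
    isQuasi {U G} w₁ × isQuasi {U G} w₂ → ∥ Homotopy M w₁ w₂ ∥

  isTraditionallySpherical⇒isSpherical : isTraditionallySpherical → isSpherical
  isTraditionallySpherical⇒isSpherical sph x y w₁ w₂ _ = sph x y w₁ w₂

  module _ (_≟_ : DecidableEquality (N G)) (sph : isSpherical) where

    isSetN : isSet (N G)
    isSetN = DecidableEquality⇒isSet _≟_

    erase-quasi-loop : ∀ {x y z} (e : E (U G) x y) (a : W (U G) y x) (b : W (U G) x z) →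
                       isQuasi {U G} (a · b) → ¬ x ∈ a → ∥ Homotopy M (e ⊙ a · b) b ∥
    erase-quasi-loop {x} e a b quasi x∉a =
      ∥-map (·-congʳ b) (sph x x (e ⊙ a) ⟨ x ⟩ (quasi-loop , isQuasi-⟨⟩ {U G} x))
      where
      quasi-loop : isQuasi {U G} (e ⊙ a)
      quasi-loop = isQuasi-⊙ {U G} isSetN e (isQuasi-·ˡ a b quasi) x∉a

    quasiRepresentative : ∀ {x z} (w : W (U G) x z) →
                          Σ (W (U G) x z) λ s → isQuasi {U G} s × ∥ Homotopy M w s ∥
    quasiRepresentative ⟨ x ⟩ = ⟨ x ⟩ , isQuasi-⟨⟩ {U G} x , ∣ hrefl ∣
    quasiRepresentative (_⊙_ {x} e w) with quasiRepresentative w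
    ... | s , quasi , w∼s with firstVisit? _≟_ x s
    ...   | inj₂ x∉s =
      e ⊙ s , isQuasi-⊙ {U G} isSetN e quasi x∉s , ∥-map (⊙-cong e) w∼s
    ...   | inj₁ (firstVisit a b x∉a refl) =
      b , isQuasi-·ʳ a b quasi ,
      ∥-map₂ (λ w∼ab e⊙ab∼b → htrans (⊙-cong e w∼ab) e⊙ab∼b)
        w∼s (erase-quasi-loop e a b quasi x∉a)

    isSpherical⇒isTraditionallySpherical : isTraditionallySpherical
    isSpherical⇒isTraditionallySpherical x y w₁ w₂
      with quasiRepresentative w₁ | quasiRepresentative w₂
    ... | s₁ , quasi₁ , w₁∼s₁ | s₂ , quasi₂ , w₂∼s₂ =
      ∥-map₂ htrans w₁∼s₁
        (∥-map₂ (λ s₁∼s₂ w₂∼s₂ → htrans s₁∼s₂ (hsym w₂∼s₂))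
          (sph x y s₁ s₂ (quasi₁ , quasi₂)) w₂∼s₂)

corollary5p8 : (G : Graph) → isSetGraph G → ((x y : N G) → Dec (x ≡ y)) →
    (M : Map G) →
    ((x y : N G) → (w₁ w₂ : W (U G) x y) → ∥ Homotopy M w₁ w₂ ∥)
      ⇔ ((x y : N G) → (w₁ w₂ : W (U G) x y) →
          isQuasi {U G} w₁ × isQuasi {U G} w₂ → ∥ Homotopy M w₁ w₂ ∥)
corollary5p8 G _ _≟_ M =
  mk⇔ (isTraditionallySpherical⇒isSpherical M) (isSpherical⇒isTraditionallySpherical M _≟_)
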